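{- Let $a$ be a descending plane partition of order $n$ with $k\ge1$ rows and no special part, with row $i$ having $m_i$ entries $a_{i,i},\dots,a_{i,i+m_i-1}$, and let $\pi$ be the permutation of $\{1,\dots,n\}$ (with exactly $k$ ascents) obtained from $a$ by the following construction. Set $m_0=n$ and start with $w_0=n(n-1)\cdots 21$. For $i=1,\dots,k$: write $w_{i-1}=u\,T$ where $T$ is the final block of $m_{i-1}$ letters of $w_{i-1}$ (a decreasing block whose set of letters we call $S$), let $\phi:S\to\{1,\dots,m_{i-1}\}$ be the order-preserving bijection, let $\gamma=(a_{i,i},a_{i,i+1}-1,\dots,a_{i,i+m_i-1}-(m_i-1))$, let $\beta$ be $\{1,\dots,m_{i-1}\}\setminus\{\gamma_1,\dots,\gamma_{m_i}\}$ in decreasing order, and set $w_i=u\,\phi^{ -1}(\beta)\,\phi^{ -1}(\gamma)$ (applying $\phi^{ -1}$ letterwise). Finally $\pi=w_k$. Then the non-inversion number of $\pi$ is $$I(\pi)=\sum_{i=1}^k\sum_{j=i}^{m_i+i-1}a_{i,j}-\sum_{i=1}^k m_i^2.$$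
   Context: A descending plane partition (DPP) is an array $a=(a_{ij})$ of positive integers, defined for $j\ge i\ge1$, arranged in $r$ rows (row $i$ starts in column $i$), row $i$ consisting of $a_{i,i},\dots,a_{i,\mu_i}$, such that: (1) $\mu_1\ge\dots\ge\mu_r$; (2) $a_{i,j}\ge a_{i,j+1}$ and $a_{i,j}>a_{i+1,j}$ whenever both sides are defined; (3) $a_{i,i}>\mu_i-i+1$ for $1\le i\le r$; (4) $a_{i,i}\le\mu_{i-1}-i+2$ for $1<i\le r$. It has order $n$ if all entries are $\le n$. An entry $a_{i,j}$ is a special part if $a_{i,j}\le j-i$. A permutation has an ascent at position $k$ if $\pi_k<\pi_{k+1}$. The non-inversion number $I(\pi)$ of a permutation $\pi$ is the number of pairs $i<j$ with $\pi_i<\pi_j$. -}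

module Defs where

open import Data.Nat using (ℕ; zero; suc; _+_; _*_; _∸_; _≤_; _<_; _<?_; _≟_)
open import Data.Nat.Properties using (≤-decTotalOrder)
open import Data.List using (List; []; _∷_; length; take; drop; map; filter; zipWith; upTo; _++_)
open import Data.List.Membership.DecPropositional _≟_ using (_∈?_)
open import Data.List.Sort.InsertionSort ≤-decTotalOrder using (sort)
open import Data.Nat.ListAction using (sum)
open import Relation.Nullary using (¬?)

-- Basic list access (0-indexed, default value outside the range).

at : List ℕ → ℕ → ℕ
at []       _       = 0
at (x ∷ xs) zero    = x
at (x ∷ xs) (suc t) = at xs t

-- A DPP is given as the list of its rows; the row with 0-based index i
-- (i.e. row i+1 of the paper) is the list a_{i+1,i+1}, ..., a_{i+1,μ_{i+1}}.
-- So  a_{i+1, i+1+t} = at (row A i) t,  and m_{i+1} = length (row A i).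
row : List (List ℕ) → ℕ → List ℕ
row []       _       = []
row (r ∷ rs) zero    = r
row (r ∷ rs) (suc i) = row rs i

len : List (List ℕ) → ℕ → ℕ
len A i = length (row A i)

-- μ of the paper for row (0-based) i, i.e. μ_{i+1} = (i+1) + m_{i+1} - 1
μ : List (List ℕ) → ℕ → ℕ
μ A i = i + len A i

ent : List (List ℕ) → ℕ → ℕ → ℕ
ent A i t = at (row A i) t

record IsDPPOfOrder (n : ℕ) (A : List (List ℕ)) : Set where
  field
    -- row i starts at column i, i.e. a_{i,i} is defined (each row nonempty)
    rowNonempty : ∀ i → i < length A → 1 ≤ len A i
    positive    : ∀ i t → i < length A → t < len A i → 1 ≤ ent A i t
    boundedByN  : ∀ i t → i < length A → t < len A i → ent A i t ≤ n
    cond1       : ∀ i → suc i < length A → μ A (suc i) ≤ μ A i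
    cond2row    : ∀ i t → i < length A → suc t < len A i →
                  ent A i (suc t) ≤ ent A i t
    -- (2b) a_{i,j} > a_{i+1,j}; column j = i+1+(s+1) = (i+2)+s
    cond2col    : ∀ i s → suc i < length A → s < len A (suc i) → suc s < len A i →
                  ent A (suc i) s < ent A i (suc s)
    -- (3) a_{i,i} > μ_i - i + 1  (= m_i)
    cond3       : ∀ i → i < length A → len A i < ent A i 0
    -- (4) a_{i,i} ≤ μ_{i-1} - i + 2  (= m_{i-1}), for i > 1
    cond4       : ∀ i → suc i < length A → ent A (suc i) 0 ≤ len A i

-- a_{i,j} is special iff a_{i,j} ≤ j - i; for a_{i+1,i+1+t}, j - i = t.
NoSpecialPart : List (List ℕ) → Set
NoSpecialPart A = ∀ i t → i < length A → t < len A i → t < ent A i t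

downTo1 : ℕ → List ℕ
downTo1 zero    = []
downTo1 (suc m) = suc m ∷ downTo1 m

step : List ℕ → ℕ → List ℕ → List ℕ
step w mp r = u ++ map φinv β ++ map φinv γ
  where
    u    = take (length w ∸ mp) w
    T    = drop (length w ∸ mp) w
    φinv : ℕ → ℕ
    φinv j = at (sort T) (j ∸ 1)
    γ    = zipWith (λ t x → x ∸ t) (upTo (length r)) r
    β    = filter (λ j → ¬? (j ∈? γ)) (downTo1 mp)

build : List ℕ → ℕ → List (List ℕ) → List ℕ
build w mp []       = w
build w mp (r ∷ rs) = build (step w mp r) (length r) rs

dppToPerm : ℕ → List (List ℕ) → List ℕ
dppToPerm n A = build (downTo1 n) n A

nonInv : List ℕ → ℕ
nonInv []       = 0
nonInv (x ∷ xs) = length (filter (x <?_) xs) + nonInv xs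

entrySum : List (List ℕ) → ℕ
entrySum A = sum (map sum A)

rowLenSqSum : List (List ℕ) → ℕ
rowLenSqSum A = sum (map (λ r → length r * length r) A)

module Submission where

-- A step keeps a prefix u and replaces the final decreasing block T, of length m′,
-- by φ⁻¹(β) φ⁻¹(γ), a permutation of T.  So the non-inversions inside u and between
-- u and the block survive, and since φ⁻¹ is increasing and β, γ are decreasing, the
-- new ones are the pairs of β × γ in increasing order.  Together with the m(m-1)/2
-- such pairs of γ × γ they are those of {1,…,m′} × γ, which number Σ_t (γ_t - 1).
-- As Σ_t γ_t = Σ_t a_{i,i+t} - m(m-1)/2, the i-th step adds Σ_t a_{i,i+t} - m²
-- non-inversions, and the initial word n ⋯ 1 has none.

open import Defs
open import Level using (0ℓ)
open import Function using (_∘′_)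
open import Data.Product using (_×_; _,_; proj₁; proj₂; uncurry)
open import Data.Sum using (inj₁; inj₂)
open import Relation.Nullary using (¬_; ¬?; Dec; yes; no)
open import Relation.Unary using (Pred; Decidable)
open import Relation.Unary.Properties using (∁?)
open import Relation.Binary.PropositionalEquality
  using (_≡_; refl; sym; trans; cong; cong₂; subst; subst₂; setoid; module ≡-Reasoning)
open import Data.Nat using (ℕ; zero; suc; _+_; _*_; _∸_; _≤_; _<_; _>_; _<?_; _≟_; z≤n; s≤s)
open import Data.Nat.Properties
open import Data.Nat.ListAction using (sum)
open import Data.Nat.Tactic.RingSolver using (solve-∀)
open import Algebra.Properties.CommutativeSemigroup +-commutativeSemigroup
  using (interchange; x∙yz≈y∙xz; x∙yz≈xz∙y; xy∙z≈xz∙y)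
open import Data.List
  using ( List; []; _∷_; [_]; _++_; _∷ʳ_; length; take; drop; map; filter; zipWith; reverse
        ; upTo; applyUpTo; applyDownFrom)
open import Data.List.Properties
  using ( length-++; length-map; map-++; ++-assoc; unfold-reverse; applyDownFrom-∷ʳ; map-applyDownFrom
        ; filter-++; filter-accept; filter-reject; filter-none; partition-defn)
open import Data.List.Relation.Unary.All as All using (All; []; _∷_)
import Data.List.Relation.Unary.All.Properties as All
open import Data.List.Relation.Unary.AllPairs as AllPairs using (AllPairs; []; _∷_)
import Data.List.Relation.Unary.AllPairs.Properties as AllPairs
open import Data.List.Relation.Unary.Linked using (Linked; []; [-]; _∷_)
open import Data.List.Relation.Unary.Linked.Properties using (Linked⇒AllPairs)
open import Data.List.Relation.Unary.Any using (here; there)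
open import Data.List.Membership.DecPropositional _≟_ using (_∈_; _∈?_)
open import Data.List.Relation.Binary.Permutation.Propositional as ↭
  using (_↭_; ↭-sym; ↭-trans; ↭⇒↭ₛ; ↭ₛ⇒↭; module PermutationReasoning)
open import Data.List.Relation.Binary.Permutation.Propositional.Properties
  using (↭-length; filter-↭; map⁺; ++-comm; ↭-reverse; All-resp-↭)
open import Data.List.Relation.Binary.Permutation.Setoid (setoid ℕ) using () renaming (_↭_ to _↭ₛ_)
open import Data.List.Relation.Binary.Permutation.Setoid.Properties (setoid ℕ) using (partition-↭; Unique-resp-↭)
open import Data.List.Sort.InsertionSort ≤-decTotalOrder using (sort)
open import Data.List.Sort.InsertionSort.Properties ≤-decTotalOrder using (sort-↭; sort-↗)

countAbove : ℕ → List ℕ → ℕ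
countAbove x ys = length (filter (x <?_) ys)

nonInvBetween : List ℕ → List ℕ → ℕ
nonInvBetween []       ys = 0
nonInvBetween (x ∷ xs) ys = countAbove x ys + nonInvBetween xs ys

countAbove-accept : ∀ {x y} ys → x < y → countAbove x (y ∷ ys) ≡ suc (countAbove x ys)
countAbove-accept ys x<y = cong length (filter-accept (_ <?_) x<y)

countAbove-reject : ∀ {x y} ys → ¬ x < y → countAbove x (y ∷ ys) ≡ countAbove x ys
countAbove-reject ys x≮y = cong length (filter-reject (_ <?_) x≮y)

countAbove-none : ∀ {x} ys → All (_< x) ys → countAbove x ys ≡ 0
countAbove-none ys ys<x = cong length (filter-none (_ <?_) (All.map <⇒≯ ys<x))

countAbove-++ : ∀ x ys zs → countAbove x (ys ++ zs) ≡ countAbove x ys + countAbove x zs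
countAbove-++ x ys zs = trans (cong length (filter-++ (x <?_) ys zs)) (length-++ (filter (x <?_) ys))

countAbove-↭ : ∀ x {ys zs} → ys ↭ zs → countAbove x ys ≡ countAbove x zs
countAbove-↭ x ys↭zs = ↭-length (filter-↭ (x <?_) ys↭zs)

nonInvBetween-[] : ∀ xs → nonInvBetween xs [] ≡ 0
nonInvBetween-[] []       = refl
nonInvBetween-[] (x ∷ xs) = nonInvBetween-[] xs

nonInvBetween-singleton-above : ∀ {y} xs → All (_< y) xs → nonInvBetween xs [ y ] ≡ length xs
nonInvBetween-singleton-above []       []             = refl
nonInvBetween-singleton-above (x ∷ xs) (x<y ∷ xs<y) =
  cong₂ _+_ (countAbove-accept [] x<y) (nonInvBetween-singleton-above xs xs<y)

nonInvBetween-++ˡ : ∀ xs ys zs → nonInvBetween (xs ++ ys) zs ≡ nonInvBetween xs zs + nonInvBetween ys zs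
nonInvBetween-++ˡ []       ys zs = refl
nonInvBetween-++ˡ (x ∷ xs) ys zs =
  trans (cong (countAbove x zs +_) (nonInvBetween-++ˡ xs ys zs)) (sym (+-assoc (countAbove x zs) _ _))

nonInvBetween-++ʳ : ∀ xs ys zs → nonInvBetween xs (ys ++ zs) ≡ nonInvBetween xs ys + nonInvBetween xs zs
nonInvBetween-++ʳ []       ys zs = refl
nonInvBetween-++ʳ (x ∷ xs) ys zs = begin
  countAbove x (ys ++ zs) + nonInvBetween xs (ys ++ zs)
    ≡⟨ cong₂ _+_ (countAbove-++ x ys zs) (nonInvBetween-++ʳ xs ys zs) ⟩
  (countAbove x ys + countAbove x zs) + (nonInvBetween xs ys + nonInvBetween xs zs)
    ≡⟨ interchange (countAbove x ys) _ _ _ ⟩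
  (countAbove x ys + nonInvBetween xs ys) + (countAbove x zs + nonInvBetween xs zs) ∎
  where open ≡-Reasoning

nonInvBetween-↭ˡ : ∀ {xs ys} zs → xs ↭ ys → nonInvBetween xs zs ≡ nonInvBetween ys zs
nonInvBetween-↭ˡ zs ↭.refl         = refl
nonInvBetween-↭ˡ zs (↭.prep x p)   = cong (countAbove x zs +_) (nonInvBetween-↭ˡ zs p)
nonInvBetween-↭ˡ zs (↭.swap x y p) =
  trans (x∙yz≈y∙xz (countAbove x zs) (countAbove y zs) _)
        (cong (λ n → countAbove y zs + (countAbove x zs + n)) (nonInvBetween-↭ˡ zs p))
nonInvBetween-↭ˡ zs (↭.trans p q)  = trans (nonInvBetween-↭ˡ zs p) (nonInvBetween-↭ˡ zs q)

nonInvBetween-↭ʳ : ∀ xs {ys zs} → ys ↭ zs → nonInvBetween xs ys ≡ nonInvBetween xs zs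
nonInvBetween-↭ʳ []       p = refl
nonInvBetween-↭ʳ (x ∷ xs) p = cong₂ _+_ (countAbove-↭ x p) (nonInvBetween-↭ʳ xs p)

nonInv-++ : ∀ xs ys → nonInv (xs ++ ys) ≡ nonInv xs + nonInvBetween xs ys + nonInv ys
nonInv-++ []       ys = refl
nonInv-++ (x ∷ xs) ys = begin
  countAbove x (xs ++ ys) + nonInv (xs ++ ys)
    ≡⟨ cong₂ _+_ (countAbove-++ x xs ys) (nonInv-++ xs ys) ⟩
  (countAbove x xs + countAbove x ys) + (nonInv xs + nonInvBetween xs ys + nonInv ys)
    ≡⟨ regroup (countAbove x xs) (countAbove x ys) (nonInv xs) (nonInvBetween xs ys) (nonInv ys) ⟩
  (countAbove x xs + nonInv xs) + (countAbove x ys + nonInvBetween xs ys) + nonInv ys ∎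
  where
  open ≡-Reasoning
  regroup : ∀ a b c d e → (a + b) + (c + d + e) ≡ (a + c) + (b + d) + e
  regroup = solve-∀

Decreasing : List ℕ → Set
Decreasing = AllPairs _>_

nonInv-decreasing : ∀ {xs} → Decreasing xs → nonInv xs ≡ 0
nonInv-decreasing {[]}     []              = refl
nonInv-decreasing {x ∷ xs} (xs<x ∷ xs↘) =
  cong₂ _+_ (countAbove-none xs xs<x) (nonInv-decreasing xs↘)

triangle : ℕ → ℕ
triangle zero    = 0
triangle (suc m) = m + triangle m

square≡2*triangle+id : ∀ m → m * m ≡ triangle m + triangle m + m
square≡2*triangle+id zero    = refl
square≡2*triangle+id (suc m) = begin
  suc m * suc m                                   ≡⟨ expand m ⟩
  m * m + (m + m + 1)                             ≡⟨ cong (_+ (m + m + 1)) (square≡2*triangle+id m) ⟩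
  triangle m + triangle m + m + (m + m + 1)       ≡⟨ regroup m (triangle m) ⟩
  (m + triangle m) + (m + triangle m) + suc m     ∎
  where
  open ≡-Reasoning
  expand : ∀ m → suc m * suc m ≡ m * m + (m + m + 1)
  expand = solve-∀
  regroup : ∀ m t → t + t + m + (m + m + 1) ≡ (m + t) + (m + t) + suc m
  regroup = solve-∀

nonInvBetween-self : ∀ {xs} → Decreasing xs → nonInvBetween xs xs ≡ triangle (length xs)
nonInvBetween-self {[]}     []             = refl
nonInvBetween-self {x ∷ xs} (xs<x ∷ xs↘) = begin
  countAbove x (x ∷ xs) + nonInvBetween xs (x ∷ xs)
    ≡⟨ cong (_+ nonInvBetween xs (x ∷ xs))
            (trans (countAbove-reject xs (<-irrefl refl)) (countAbove-none xs xs<x)) ⟩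
  nonInvBetween xs ([ x ] ++ xs)
    ≡⟨ nonInvBetween-++ʳ xs [ x ] xs ⟩
  nonInvBetween xs [ x ] + nonInvBetween xs xs
    ≡⟨ cong₂ _+_ (nonInvBetween-singleton-above xs xs<x) (nonInvBetween-self xs↘) ⟩
  length xs + triangle (length xs) ∎
  where open ≡-Reasoning

-- Relabelling by a strictly monotone map

StrictlyMonotoneOn : Pred ℕ 0ℓ → (ℕ → ℕ) → Set
StrictlyMonotoneOn P f = ∀ {a b} → P a → P b → a < b → f a < f b

module _ {P : Pred ℕ 0ℓ} {f : ℕ → ℕ} (f-mono : StrictlyMonotoneOn P f) where

  private
    f-monotone : ∀ {a b} → P a → P b → a ≤ b → f a ≤ f b
    f-monotone pa pb a≤b with m≤n⇒m<n∨m≡n a≤b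
    ... | inj₁ a<b  = <⇒≤ (f-mono pa pb a<b)
    ... | inj₂ refl = ≤-refl

  countAbove-map : ∀ {x} ys → P x → All P ys → countAbove (f x) (map f ys) ≡ countAbove x ys
  countAbove-map []       px []         = refl
  countAbove-map {x} (y ∷ ys) px (py ∷ pys) with x <? y
  ... | yes x<y = trans (countAbove-accept (map f ys) (f-mono px py x<y))
                        (trans (cong suc (countAbove-map ys px pys)) (sym (countAbove-accept ys x<y)))
  ... | no  x≮y = trans (countAbove-reject (map f ys) (≤⇒≯ (f-monotone py px (≮⇒≥ x≮y))))
                        (trans (countAbove-map ys px pys) (sym (countAbove-reject ys x≮y)))

  nonInv-map : ∀ xs → All P xs → nonInv (map f xs) ≡ nonInv xs
  nonInv-map []       []         = refl
  nonInv-map (x ∷ xs) (px ∷ pxs) = cong₂ _+_ (countAbove-map xs px pxs) (nonInv-map xs pxs)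

  decreasing-map : ∀ {xs} → All P xs → Decreasing xs → Decreasing (map f xs)
  decreasing-map []         []            = []
  decreasing-map (px ∷ pxs) (xs<x ∷ xs↘) =
    All.map⁺ (All.zipWith (λ (py , y<x) → f-mono py px y<x) (pxs , xs<x)) ∷ decreasing-map pxs xs↘

InRange : ℕ → Pred ℕ 0ℓ
InRange m j = 1 ≤ j × j ≤ m

length-downTo1 : ∀ m → length (downTo1 m) ≡ m
length-downTo1 zero    = refl
length-downTo1 (suc m) = cong suc (length-downTo1 m)

downTo1-inRange : ∀ m → All (InRange m) (downTo1 m)
downTo1-inRange zero    = []
downTo1-inRange (suc m) =
  (s≤s z≤n , ≤-refl) ∷ All.map (λ (1≤j , j≤m) → 1≤j , m≤n⇒m≤1+n j≤m) (downTo1-inRange m)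

downTo1-below : ∀ m → All (_< suc m) (downTo1 m)
downTo1-below m = All.map (λ (_ , j≤m) → s≤s j≤m) (downTo1-inRange m)

downTo1-decreasing : ∀ m → Decreasing (downTo1 m)
downTo1-decreasing zero    = []
downTo1-decreasing (suc m) = downTo1-below m ∷ downTo1-decreasing m

downTo1≡applyDownFrom : ∀ m → downTo1 m ≡ applyDownFrom suc m
downTo1≡applyDownFrom zero    = refl
downTo1≡applyDownFrom (suc m) = cong (suc m ∷_) (downTo1≡applyDownFrom m)

suc-nonInvBetween-downTo1-singleton : ∀ {m g} → 1 ≤ g → g ≤ suc m →
  suc (nonInvBetween (downTo1 m) [ g ]) ≡ g
suc-nonInvBetween-downTo1-singleton {zero}  {suc zero}    _ _          = refl
suc-nonInvBetween-downTo1-singleton {zero}  {suc (suc _)} _ (s≤s ())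
suc-nonInvBetween-downTo1-singleton {suc m} {g} 1≤g g≤2+m with suc m <? g
... | yes 1+m<g = begin
  suc (countAbove (suc m) [ g ] + nonInvBetween (downTo1 m) [ g ])
    ≡⟨ cong₂ (λ c n → suc (c + n)) (countAbove-accept [] 1+m<g)
             (nonInvBetween-singleton-above (downTo1 m)
               (All.map (λ j<1+m → <-trans j<1+m 1+m<g) (downTo1-below m))) ⟩
  suc (suc (length (downTo1 m)))
    ≡⟨ cong (suc ∘′ suc) (length-downTo1 m) ⟩
  suc (suc m)
    ≡⟨ ≤-antisym 1+m<g g≤2+m ⟩
  g ∎
  where open ≡-Reasoning
... | no 1+m≮g = trans (cong (λ c → suc (c + nonInvBetween (downTo1 m) [ g ])) (countAbove-reject [] 1+m≮g))
                       (suc-nonInvBetween-downTo1-singleton 1≤g (≮⇒≥ 1+m≮g))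

nonInvBetween-downTo1 : ∀ m {ys} → All (InRange m) ys → nonInvBetween (downTo1 m) ys + length ys ≡ sum ys
nonInvBetween-downTo1 m {[]}     []                  = trans (+-identityʳ _) (nonInvBetween-[] (downTo1 m))
nonInvBetween-downTo1 m {g ∷ ys} ((1≤g , g≤m) ∷ pys) = begin
  nonInvBetween (downTo1 m) ([ g ] ++ ys) + suc (length ys)
    ≡⟨ cong (_+ suc (length ys)) (nonInvBetween-++ʳ (downTo1 m) [ g ] ys) ⟩
  nonInvBetween (downTo1 m) [ g ] + nonInvBetween (downTo1 m) ys + suc (length ys)
    ≡⟨ regroup (nonInvBetween (downTo1 m) [ g ]) _ _ ⟩
  suc (nonInvBetween (downTo1 m) [ g ]) + (nonInvBetween (downTo1 m) ys + length ys)
    ≡⟨ cong₂ _+_ (suc-nonInvBetween-downTo1-singleton 1≤g (m≤n⇒m≤1+n g≤m))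
                 (nonInvBetween-downTo1 m pys) ⟩
  g + sum ys ∎
  where
  open ≡-Reasoning
  regroup : ∀ a b c → a + b + suc c ≡ suc a + (b + c)
  regroup = solve-∀

filter-∈-∷-below : ∀ {k} ys {xs} → All (_< k) xs → filter (_∈? k ∷ ys) xs ≡ filter (_∈? ys) xs
filter-∈-∷-below ys {[]}     []            = refl
filter-∈-∷-below {k} ys {x ∷ xs} (x<k ∷ xs<k) = by-cases (x ∈? ys)
  where
  by-cases : Dec (x ∈ ys) → filter (_∈? k ∷ ys) (x ∷ xs) ≡ filter (_∈? ys) (x ∷ xs)
  by-cases (yes x∈ys) = begin
    filter (_∈? k ∷ ys) (x ∷ xs) ≡⟨ filter-accept (_∈? k ∷ ys) (there x∈ys) ⟩
    x ∷ filter (_∈? k ∷ ys) xs   ≡⟨ cong (x ∷_) (filter-∈-∷-below ys xs<k) ⟩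
    x ∷ filter (_∈? ys) xs       ≡⟨ filter-accept (_∈? ys) x∈ys ⟨
    filter (_∈? ys) (x ∷ xs)     ∎
    where open ≡-Reasoning
  by-cases (no x∉ys) = begin
    filter (_∈? k ∷ ys) (x ∷ xs) ≡⟨ filter-reject (_∈? k ∷ ys) x∉k∷ys ⟩
    filter (_∈? k ∷ ys) xs       ≡⟨ filter-∈-∷-below ys xs<k ⟩
    filter (_∈? ys) xs           ≡⟨ filter-reject (_∈? ys) x∉ys ⟨
    filter (_∈? ys) (x ∷ xs)     ∎
    where
    open ≡-Reasoning
    x∉k∷ys : ¬ x ∈ k ∷ ys
    x∉k∷ys (here x≡k)    = <⇒≢ x<k x≡k
    x∉k∷ys (there x∈ys) = x∉ys x∈ys

All-inRange-below : ∀ {m g ys} → All (InRange (suc m)) ys → All (_< g) ys → g ≤ suc m → All (InRange m) ys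
All-inRange-below ys∈ ys<g g≤1+m =
  All.zipWith (λ ((1≤y , _) , y<g) → 1≤y , ≤-pred (<-≤-trans y<g g≤1+m)) (ys∈ , ys<g)

filter-∈-downTo1 : ∀ m {ys} → Decreasing ys → All (InRange m) ys → filter (_∈? ys) (downTo1 m) ≡ ys
filter-∈-downTo1 m       {[]}     _ _                = filter-none (_∈? []) (All.universal (λ _ ()) (downTo1 m))
filter-∈-downTo1 zero    {_ ∷ _}  _ ((s≤s _ , ()) ∷ _)
filter-∈-downTo1 (suc m) {g ∷ ys} (ys<g ∷ ys↘) ((1≤g , g≤1+m) ∷ ys∈) with g ≟ suc m
... | yes refl = begin
  filter (_∈? g ∷ ys) (g ∷ downTo1 m) ≡⟨ filter-accept (_∈? g ∷ ys) (here refl) ⟩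
  g ∷ filter (_∈? g ∷ ys) (downTo1 m) ≡⟨ cong (g ∷_) (filter-∈-∷-below ys (downTo1-below m)) ⟩
  g ∷ filter (_∈? ys) (downTo1 m)
    ≡⟨ cong (g ∷_) (filter-∈-downTo1 m ys↘ (All-inRange-below ys∈ ys<g ≤-refl)) ⟩
  g ∷ ys                              ∎
  where open ≡-Reasoning
... | no  g≢1+m = trans (filter-reject (_∈? g ∷ ys) (All.All¬⇒¬Any (All.map >⇒≢ g∷ys<1+m)))
                        (filter-∈-downTo1 m (ys<g ∷ ys↘)
                          ((1≤g , ≤-pred g<1+m) ∷ All-inRange-below ys∈ ys<g g≤1+m))
  where
  g<1+m : g < suc m
  g<1+m = ≤∧≢⇒< g≤1+m g≢1+m
  g∷ys<1+m : All (_< suc m) (g ∷ ys)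
  g∷ys<1+m = g<1+m ∷ All.map (λ y<g → <-trans y<g g<1+m) ys<g

filter-∁-++-filter-↭ : ∀ {p} {P : Pred ℕ p} (P? : Decidable P) xs → filter (∁? P?) xs ++ filter P? xs ↭ xs
filter-∁-++-filter-↭ P? xs = ↭-trans (++-comm (filter (∁? P?) xs) _)
  (↭-sym (↭ₛ⇒↭ (subst (λ parts → xs ↭ₛ proj₁ parts ++ proj₂ parts)
                       (partition-defn P? xs) (partition-↭ P? xs))))

-- β of the construction
complement : ℕ → List ℕ → List ℕ
complement m ys = filter (λ j → ¬? (j ∈? ys)) (downTo1 m)

complement-++-↭ : ∀ m {ys} → Decreasing ys → All (InRange m) ys → complement m ys ++ ys ↭ downTo1 m
complement-++-↭ m ys↘ ys∈ = subst (λ zs → complement m _ ++ zs ↭ downTo1 m)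
  (filter-∈-downTo1 m ys↘ ys∈) (filter-∁-++-filter-↭ (_∈? _) (downTo1 m))

complement-decreasing : ∀ m ys → Decreasing (complement m ys)
complement-decreasing m ys = AllPairs.filter⁺ (λ j → ¬? (j ∈? ys)) (downTo1-decreasing m)

nonInv-complement-++ : ∀ m {ys} → Decreasing ys → All (InRange m) ys →
  nonInv (complement m ys ++ ys) + triangle (length ys) + length ys ≡ sum ys
nonInv-complement-++ m {ys} ys↘ ys∈ = begin
  nonInv (β ++ ys) + triangle (length ys) + length ys
    ≡⟨ cong (λ n → n + triangle (length ys) + length ys) nonInv-β++ys ⟩
  nonInvBetween β ys + triangle (length ys) + length ys
    ≡⟨ cong (λ n → nonInvBetween β ys + n + length ys) (nonInvBetween-self ys↘) ⟨
  nonInvBetween β ys + nonInvBetween ys ys + length ys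
    ≡⟨ cong (_+ length ys) (nonInvBetween-++ˡ β ys ys) ⟨
  nonInvBetween (β ++ ys) ys + length ys
    ≡⟨ cong (_+ length ys) (nonInvBetween-↭ˡ ys (complement-++-↭ m ys↘ ys∈)) ⟩
  nonInvBetween (downTo1 m) ys + length ys
    ≡⟨ nonInvBetween-downTo1 m ys∈ ⟩
  sum ys ∎
  where
  open ≡-Reasoning
  β = complement m ys
  nonInv-β++ys : nonInv (β ++ ys) ≡ nonInvBetween β ys
  nonInv-β++ys rewrite nonInv-++ β ys | nonInv-decreasing (complement-decreasing m ys) | nonInv-decreasing ys↘ =
    +-identityʳ (nonInvBetween β ys)

-- φ⁻¹: the j-th smallest letter of a block

unrank : List ℕ → ℕ → ℕ
unrank T j = at (sort T) (j ∸ 1)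

sort-increasing : ∀ {T} → Decreasing T → AllPairs _<_ (sort T)
sort-increasing {T} T↘ = AllPairs.zipWith (uncurry ≤∧≢⇒<)
  ( Linked⇒AllPairs ≤-trans (sort-↗ T)
  , Unique-resp-↭ (↭⇒↭ₛ (↭-sym (sort-↭ T))) (AllPairs.map >⇒≢ T↘))

All-at : ∀ {p} {P : Pred ℕ p} {xs j} → All P xs → j < length xs → P (at xs j)
All-at {j = zero}  (px ∷ _)   _         = px
All-at {j = suc j} (_ ∷ pxs) (s≤s j<n) = All-at pxs j<n

at-increasing : ∀ {xs i j} → AllPairs _<_ xs → i < j → j < length xs → at xs i < at xs j
at-increasing {x ∷ xs} {zero}  {suc j} (x<xs ∷ _)  _         (s≤s j<n) = All-at x<xs j<n
at-increasing {x ∷ xs} {suc i} {suc j} (_ ∷ xs↗) (s≤s i<j) (s≤s j<n) = at-increasing xs↗ i<j j<n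

unrank-strictlyMonotone : ∀ {T} → Decreasing T → StrictlyMonotoneOn (InRange (length T)) (unrank T)
unrank-strictlyMonotone {T} T↘ {suc a} {suc b} _ (_ , b≤n) (s≤s a<b) =
  at-increasing (sort-increasing T↘) a<b (subst (b <_) (sym (↭-length (sort-↭ T))) b≤n)

applyDownFrom-at : ∀ xs → applyDownFrom (at xs) (length xs) ≡ reverse xs
applyDownFrom-at []       = refl
applyDownFrom-at (x ∷ xs) = begin
  applyDownFrom (at (x ∷ xs)) (suc (length xs)) ≡⟨ applyDownFrom-∷ʳ (at (x ∷ xs)) (length xs) ⟨
  applyDownFrom (at xs) (length xs) ∷ʳ x        ≡⟨ cong (_∷ʳ x) (applyDownFrom-at xs) ⟩
  reverse xs ∷ʳ x                               ≡⟨ unfold-reverse x xs ⟨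
  reverse (x ∷ xs)                              ∎
  where open ≡-Reasoning

map-unrank-downTo1 : ∀ T → map (unrank T) (downTo1 (length T)) ↭ T
map-unrank-downTo1 T = begin
  map (unrank T) (downTo1 (length T))
    ≡⟨ cong (λ n → map (unrank T) (downTo1 n)) (↭-length (sort-↭ T)) ⟨
  map (unrank T) (downTo1 (length (sort T)))
    ≡⟨ cong (map (unrank T)) (downTo1≡applyDownFrom (length (sort T))) ⟩
  map (unrank T) (applyDownFrom suc (length (sort T)))
    ≡⟨ map-applyDownFrom suc (unrank T) (length (sort T)) ⟩
  applyDownFrom (at (sort T)) (length (sort T))
    ≡⟨ applyDownFrom-at (sort T) ⟩
  reverse (sort T)
    ↭⟨ ↭-reverse (sort T) ⟩
  sort T
    ↭⟨ sort-↭ T ⟩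
  T ∎
  where open PermutationReasoning

-- γ: a row with its distances to the diagonal subtracted

-- r lists a_{i,i+k}, a_{i,i+k+1}, …; aboveDiagonal says that none of them is special
record ValidRow (k : ℕ) (r : List ℕ) : Set where
  field
    aboveDiagonal : ∀ t → t < length r → k + t < at r t
    nonIncreasing : ∀ t → suc t < length r → at r (suc t) ≤ at r t
open ValidRow

ValidRow-tail : ∀ {k x xs} → ValidRow k (x ∷ xs) → ValidRow (suc k) xs
ValidRow-tail {k} {xs = xs} valid .aboveDiagonal t t<n =
  subst (_< at xs t) (+-suc k t) (aboveDiagonal valid (suc t) (s≤s t<n))
ValidRow-tail valid .nonIncreasing t 1+t<n = nonIncreasing valid (suc t) (s≤s 1+t<n)

ValidRow-head : ∀ {k x xs} → ValidRow k (x ∷ xs) → k < x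
ValidRow-head {k} valid = subst (_< _) (+-identityʳ k) (aboveDiagonal valid 0 (s≤s z≤n))

unshift : ℕ → List ℕ → List ℕ
unshift k []       = []
unshift k (x ∷ xs) = x ∸ k ∷ unshift (suc k) xs

zipWith-∸-applyUpTo : ∀ (f : ℕ → ℕ) k r → (∀ t → f t ≡ k + t) →
  zipWith (λ t x → x ∸ t) (applyUpTo f (length r)) r ≡ unshift k r
zipWith-∸-applyUpTo f k []      f≗k+ = refl
zipWith-∸-applyUpTo f k (x ∷ r) f≗k+ = cong₂ _∷_
  (cong (x ∸_) (trans (f≗k+ 0) (+-identityʳ k)))
  (zipWith-∸-applyUpTo (f ∘′ suc) (suc k) r (λ t → trans (f≗k+ (suc t)) (+-suc k t)))

length-unshift : ∀ k r → length (unshift k r) ≡ length r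
length-unshift k []      = refl
length-unshift k (x ∷ r) = cong suc (length-unshift (suc k) r)

sum-unshift : ∀ {k} r → ValidRow k r → sum (unshift k r) + (k * length r + triangle (length r)) ≡ sum r
sum-unshift {k} []      _     = cong (_+ 0) (*-zeroʳ k)
sum-unshift {k} (x ∷ r) valid = begin
  (x ∸ k + sum (unshift (suc k) r)) + (k * suc (length r) + (length r + triangle (length r)))
    ≡⟨ regroup (x ∸ k) (sum (unshift (suc k) r)) k (length r) (triangle (length r)) ⟩
  (x ∸ k + k) + (sum (unshift (suc k) r) + (suc k * length r + triangle (length r)))
    ≡⟨ cong₂ _+_ (m∸n+n≡m (<⇒≤ (ValidRow-head valid))) (sum-unshift r (ValidRow-tail valid)) ⟩
  x + sum r ∎
  where
  open ≡-Reasoning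
  regroup : ∀ a s k l t → (a + s) + (k * suc l + (l + t)) ≡ (a + k) + (s + (suc k * l + t))
  regroup = solve-∀

unshift-positive : ∀ {k} r → ValidRow k r → All (1 ≤_) (unshift k r)
unshift-positive []      _     = []
unshift-positive (x ∷ r) valid = m<n⇒0<n∸m (ValidRow-head valid) ∷ unshift-positive r (ValidRow-tail valid)

unshift-decreasing : ∀ {k} r → ValidRow k r → Decreasing (unshift k r)
unshift-decreasing r valid = Linked⇒AllPairs (λ z<y y<x → <-trans y<x z<y) (linked r valid)
  where
  linked : ∀ {k} r → ValidRow k r → Linked _>_ (unshift k r)
  linked []          _     = []
  linked (x ∷ [])    _     = [-]
  linked {k} (x ∷ y ∷ r) valid = y∸1+k<x∸k ∷ linked (y ∷ r) (ValidRow-tail valid)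
    where
    y∸1+k<x∸k : y ∸ suc k < x ∸ k
    y∸1+k<x∸k = <-≤-trans (∸-monoʳ-< (n<1+n k) (<⇒≤ (ValidRow-head (ValidRow-tail valid))))
                          (∸-monoˡ-≤ k (nonIncreasing valid 0 (s≤s (s≤s z≤n))))

unshift-inRange : ∀ {k m} r → ValidRow k r → at r 0 ≤ m → All (InRange m) (unshift k r)
unshift-inRange         []      _     _   = []
unshift-inRange {k} {m} (x ∷ r) valid x≤m =
  (All.head positive , x∸k≤m)
  ∷ All.zipWith (λ (1≤y , y<x∸k) → 1≤y , <⇒≤ (<-≤-trans y<x∸k x∸k≤m))
                (All.tail positive , AllPairs.head (unshift-decreasing (x ∷ r) valid))
  where
  positive = unshift-positive (x ∷ r) valid
  x∸k≤m : x ∸ k ≤ m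
  x∸k≤m = ≤-trans (m∸n≤m x k) x≤m

take-length-++ : ∀ (u v : List ℕ) → take (length u) (u ++ v) ≡ u
take-length-++ []      v = refl
take-length-++ (x ∷ u) v = cong (x ∷_) (take-length-++ u v)

drop-length-++ : ∀ (u v : List ℕ) → drop (length u) (u ++ v) ≡ v
drop-length-++ []      v = refl
drop-length-++ (x ∷ u) v = drop-length-++ u v

zipWith-∸-upTo : ∀ r → zipWith (λ t x → x ∸ t) (upTo (length r)) r ≡ unshift 0 r
zipWith-∸-upTo r = zipWith-∸-applyUpTo (λ t → t) 0 r (λ _ → refl)

step-++ : ∀ u T r → step (u ++ T) (length T) r
                  ≡ u ++ map (unrank T) (complement (length T) (unshift 0 r) ++ unshift 0 r)
step-++ u T r
  rewrite length-++ u {T} | m+n∸n≡m (length u) (length T) | take-length-++ u T | drop-length-++ u T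
        | zipWith-∸-upTo r = cong (u ++_) (sym (map-++ (unrank T) (complement (length T) (unshift 0 r)) (unshift 0 r)))

data EndsDecreasing : ℕ → List ℕ → Set where
  _++↘_ : ∀ u {T} → Decreasing T → EndsDecreasing (length T) (u ++ T)

module Step (u : List ℕ) {T r : List ℕ}
            (T↘ : Decreasing T) (valid : ValidRow 0 r) (r₀≤m : at r 0 ≤ length T) where

  private
    m = length T
    f = unrank T
    γ = unshift 0 r
    β = complement m γ

    γ↘ : Decreasing γ
    γ↘ = unshift-decreasing r valid

    γ∈ : All (InRange m) γ
    γ∈ = unshift-inRange r valid r₀≤m

    β++γ↭downTo1 : β ++ γ ↭ downTo1 m
    β++γ↭downTo1 = complement-++-↭ m γ↘ γ∈

    β++γ∈ : All (InRange m) (β ++ γ)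
    β++γ∈ = All-resp-↭ (↭-sym β++γ↭downTo1) (downTo1-inRange m)

    f-mono : StrictlyMonotoneOn (InRange m) f
    f-mono = unrank-strictlyMonotone T↘

    relabelled↭T : map f (β ++ γ) ↭ T
    relabelled↭T = ↭-trans (map⁺ f β++γ↭downTo1) (map-unrank-downTo1 T)

    nonInv-β++γ : nonInv (β ++ γ) + triangle (length r) + length r ≡ sum γ
    nonInv-β++γ = subst (λ l → nonInv (β ++ γ) + triangle l + l ≡ sum γ) (length-unshift 0 r)
                        (nonInv-complement-++ m γ↘ γ∈)

    nonInv-u++T : nonInv (u ++ T) ≡ nonInv u + nonInvBetween u T
    nonInv-u++T = trans (nonInv-++ u T)
      (trans (cong (nonInv u + nonInvBetween u T +_) (nonInv-decreasing T↘)) (+-identityʳ _))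

  nonInv-step : nonInv (step (u ++ T) m r) + length r * length r ≡ nonInv (u ++ T) + sum r
  nonInv-step = begin
    nonInv (step (u ++ T) m r) + length r * length r
      ≡⟨ cong₂ _+_ (cong nonInv (step-++ u T r)) (square≡2*triangle+id (length r)) ⟩
    nonInv (u ++ map f (β ++ γ)) + (t + t + l)
      ≡⟨ cong (_+ (t + t + l)) (nonInv-++ u (map f (β ++ γ))) ⟩
    nonInv u + nonInvBetween u (map f (β ++ γ)) + nonInv (map f (β ++ γ)) + (t + t + l)
      ≡⟨ cong₂ (λ a b → nonInv u + a + b + (t + t + l))
               (nonInvBetween-↭ʳ u relabelled↭T) (nonInv-map f-mono (β ++ γ) β++γ∈) ⟩
    nonInv u + nonInvBetween u T + nonInv (β ++ γ) + (t + t + l)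
      ≡⟨ regroup (nonInv u + nonInvBetween u T) (nonInv (β ++ γ)) t l ⟩
    nonInv u + nonInvBetween u T + ((nonInv (β ++ γ) + t + l) + t)
      ≡⟨ cong₂ (λ a b → a + (b + t)) (sym nonInv-u++T) nonInv-β++γ ⟩
    nonInv (u ++ T) + (sum γ + t)
      ≡⟨ cong (nonInv (u ++ T) +_) (sum-unshift r valid) ⟩
    nonInv (u ++ T) + sum r ∎
    where
    open ≡-Reasoning
    l = length r
    t = triangle l
    regroup : ∀ a b t l → a + b + (t + t + l) ≡ a + ((b + t + l) + t)
    regroup = solve-∀

  step-endsDecreasing : EndsDecreasing (length r) (step (u ++ T) m r)
  step-endsDecreasing = subst₂ EndsDecreasing (trans (length-map f γ) (length-unshift 0 r)) reassociated
    ((u ++ map f β) ++↘ decreasing-map f-mono γ∈ γ↘)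
    where
    reassociated : (u ++ map f β) ++ map f γ ≡ step (u ++ T) m r
    reassociated = trans (++-assoc u (map f β) (map f γ))
                     (trans (cong (u ++_) (sym (map-++ f β γ))) (sym (step-++ u T r)))

data AdmissibleRows : ℕ → List (List ℕ) → Set where
  []  : ∀ {m} → AdmissibleRows m []
  _∷_ : ∀ {m r rs} → ValidRow 0 r × at r 0 ≤ m → AdmissibleRows (length r) rs → AdmissibleRows m (r ∷ rs)

nonInv-build : ∀ {m w rs} → EndsDecreasing m w → AdmissibleRows m rs →
  nonInv (build w m rs) + rowLenSqSum rs ≡ nonInv w + entrySum rs
nonInv-build _ [] = refl
nonInv-build {rs = r ∷ rs} (_++↘_ u {T} T↘) ((valid , r₀≤m) ∷ rows) = begin
  nonInv (build w′ (length r) rs) + (length r * length r + rowLenSqSum rs)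
    ≡⟨ x∙yz≈xz∙y (nonInv (build w′ (length r) rs)) _ _ ⟩
  nonInv (build w′ (length r) rs) + rowLenSqSum rs + length r * length r
    ≡⟨ cong (_+ length r * length r) (nonInv-build (Step.step-endsDecreasing u T↘ valid r₀≤m) rows) ⟩
  nonInv w′ + entrySum rs + length r * length r
    ≡⟨ xy∙z≈xz∙y (nonInv w′) _ _ ⟩
  nonInv w′ + length r * length r + entrySum rs
    ≡⟨ cong (_+ entrySum rs) (Step.nonInv-step u T↘ valid r₀≤m) ⟩
  nonInv (u ++ T) + sum r + entrySum rs
    ≡⟨ +-assoc (nonInv (u ++ T)) (sum r) (entrySum rs) ⟩
  nonInv (u ++ T) + (sum r + entrySum rs) ∎
  where
  open ≡-Reasoning
  w′ = step (u ++ T) (length T) r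

admissibleRows : ∀ m rs → NoSpecialPart rs →
  (∀ i t → i < length rs → suc t < len rs i → ent rs i (suc t) ≤ ent rs i t) →
  (∀ i → suc i < length rs → ent rs (suc i) 0 ≤ len rs i) →
  (0 < length rs → ent rs 0 0 ≤ m) →
  AdmissibleRows m rs
admissibleRows m []       _         _              _            _        = []
admissibleRows m (r ∷ rs) noSpecial nonIncreasing′ firstEntry≤ r₀≤m =
  (valid , r₀≤m (s≤s z≤n))
  ∷ admissibleRows (length r) rs (λ i t i<k → noSpecial (suc i) t (s≤s i<k))
      (λ i t i<k → nonIncreasing′ (suc i) t (s≤s i<k)) (λ i i<k → firstEntry≤ (suc i) (s≤s i<k))
      (λ 0<k → firstEntry≤ 0 (s≤s 0<k))
  where
  valid : ValidRow 0 r
  valid .aboveDiagonal t = noSpecial 0 t (s≤s z≤n)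
  valid .nonIncreasing t = nonIncreasing′ 0 t (s≤s z≤n)

corollary4p3 : (n : ℕ) (A : List (List ℕ)) →
               IsDPPOfOrder n A → 1 ≤ length A → NoSpecialPart A →
               nonInv (dppToPerm n A) + rowLenSqSum A ≡ entrySum A
corollary4p3 n A dpp _ noSpecial = begin
  nonInv (dppToPerm n A) + rowLenSqSum A ≡⟨ nonInv-build start rows ⟩
  nonInv (downTo1 n) + entrySum A        ≡⟨ cong (_+ entrySum A) (nonInv-decreasing (downTo1-decreasing n)) ⟩
  entrySum A                             ∎
  where
  open ≡-Reasoning
  open IsDPPOfOrder dpp
  start : EndsDecreasing n (downTo1 n)
  start = subst (λ m → EndsDecreasing m (downTo1 n)) (length-downTo1 n) ([] ++↘ downTo1-decreasing n)
  rows : AdmissibleRows n A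
  rows = admissibleRows n A noSpecial cond2row cond4 (λ 0<k → boundedByN 0 0 0<k (rowNonempty 0 0<k))
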